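{- Let $(t_n)_{n\ge0}$ be the Thue–Morse sequence. Let $L_J$ be the set of binary words $w_{n-1}\cdots w_0$ (leading zeroes allowed) such that there is no index $i\in\{0,\dots,n-2\}$ with $w_{i+1}=1$, $w_i=0$ and $t_i=0$, and let $u_n$ be the number of words of length $n$ in $L_J$. Let $\alpha=\sqrt[6]{24}$. Then there are real constants $c_1,c_2$ such that $n^{c_1}\alpha^n\le u_n\le n^{c_2}\alpha^n$ for all integers $n\ge2$.
   Context: The Thue–Morse sequence is defined by $t_n=$ (number of $1$'s in the binary expansion of $n$) mod $2$; so $t=0110100110010110\cdots$. -}

module Defs where

open import Data.Nat using (ℕ; zero; suc; _+_; _/_; _%_)
open import Data.Bool using (Bool; true; false; not; _∧_; _xor_)
open import Data.List using (List; []; _∷_; map; _++_; filter; length)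
open import Data.Vec using (Vec; []; _∷_; toList)
open import Relation.Binary.PropositionalEquality using (_≡_)
open import Data.Bool.Properties using (_≟_)

-- Number of 1's in the binary expansion of n, computed with fuel.
-- The fuel f = n suffices, since each step halves n (n / 2^n = 0).
onesAux : ℕ → ℕ → ℕ
onesAux zero    n = 0
onesAux (suc f) n = n % 2 + onesAux f (n / 2)

ones : ℕ → ℕ
ones n = onesAux n n

t : ℕ → Bool
t n with ones n % 2
... | zero = false
... | suc _ = true

-- A binary word w_{n-1} ⋯ w_0 is a Vec Bool n whose k-th entry (from the head)
-- is w_k (true = 1, false = 0).
-- All 2^n binary words of length n (each exactly once).
allWords : (n : ℕ) → List (Vec Bool n)
allWords zero    = [] ∷ []
allWords (suc n) = map (false ∷_) (allWords n) ++ map (true ∷_) (allWords n)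

okFrom : ℕ → List Bool → Bool
okFrom i (a ∷ b ∷ rest) = not (b ∧ not a ∧ not (t i)) ∧ okFrom (suc i) (b ∷ rest)
okFrom i _              = true

inLJ : {n : ℕ} → Vec Bool n → Bool
inLJ w = okFrom 0 (toList w)

u : ℕ → ℕ
u n = length (filter (λ w → inLJ w ≟ true) (allWords n))

{-# OPTIONS --safe #-}
-- Let N_i(a, L) count the words w of length L for which a w, with the letter a at position i, has
-- no forbidden factor. At an even position 2j and for L ≥ 1, N_{2j}(1, L) is N_{2j}(0, L) if t_j = 1
-- and 2 N_{2j}(0, L) if t_j = 0, so two positions can be passed at once:
-- N_{2m}(0, K + 2) = g(t_m, t_{m+1}) N_{2m+2}(0, K) for K ≥ 1,
-- with g(00) = 3, g(01) = 2, g(10) = 4, g(11) = 3.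
-- Hence u_{2L+K+2} = 3 P_L N_{2L}(0, K + 1) with P_L = ∏_{i<L} g(t_i, t_{i+1}) and a last factor
-- between 1 and 4. Up to the telescoping factor 9^{t_i - t_{i+1}}, g^6/576 is 81/64 on equal pairs,
-- 64/81 on falls 10 and 1 on rises 01, so P_L^6 = 576^L (81/64)^{D_L} / 9^{t_L}, where D_L counts
-- equal pairs minus falls among t_0 … t_L. Since t_{2i} = t_i and t_{2i+1} = 1 - t_i,
-- D_{2N} + D_N = t_N and D_{2N+1} + D_N = 0, so |D_N| ≤ log₂ N + 1 and (81/64)^{D_L} is
-- polynomially bounded; as 576 = 24², u_n^6 and 24^n agree up to polynomial factors.
-- In ℕ, (81/64)^{D_L} is carried by the two products of weight 81 64 and weight 64 81 over the
-- first L pairs, that is 81^E 64^F and 64^E 81^F for E equal pairs and F falls.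
module Submission where

open import Defs
open import Data.Bool using (Bool; true; false; not; _∧_; _∨_; if_then_else_)
open import Data.Bool.Properties using (_≟_; not-involutive)
open import Data.List using (List; []; _∷_; map; _++_; filter; length)
open import Data.List.Properties using (filter-++; length-++)
open import Data.Nat hiding (_≟_)
open import Data.Nat.Properties hiding (_≟_)
open import Data.Nat.DivMod
open import Data.Product using (∃; ∃₂; _×_; _,_; proj₁; proj₂)
open import Data.Sum using (_⊎_; inj₁; inj₂)
open import Data.Vec using (Vec; _∷_; toList)
open import Function using (_∘_)
open import Relation.Binary.PropositionalEquality
open import Data.Nat.Tactic.RingSolver using (solve-∀)

-- Thue–Morse recurrences

bit : Bool → ℕ
bit false = 0
bit true  = 1

isOdd : ℕ → Bool
isOdd zero    = false
isOdd (suc n) = not (isOdd n)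

%2≡bit∘isOdd : ∀ n → n % 2 ≡ bit (isOdd n)
%2≡bit∘isOdd zero          = refl
%2≡bit∘isOdd (suc zero)    = refl
%2≡bit∘isOdd (suc (suc n)) = trans (%2≡bit∘isOdd n) (cong bit (sym (not-involutive _)))

t≡isOdd∘ones : ∀ n → t n ≡ isOdd (ones n)
t≡isOdd∘ones n with isOdd (ones n) | ones n % 2 | %2≡bit∘isOdd (ones n)
... | false | .0 | refl = refl
... | true  | .1 | refl = refl

onesAux-zero : ∀ f → onesAux f 0 ≡ 0
onesAux-zero zero    = refl
onesAux-zero (suc f) = onesAux-zero f

m≤1+n⇒m/2≤n : ∀ {n f} → n ≤ suc f → n / 2 ≤ f
m≤1+n⇒m/2≤n {n} {f} n≤1+f =
  ≤-trans (/-monoˡ-≤ 2 n≤1+f) (s≤s⁻¹ (m/n<m (suc f) 2 (s≤s (s≤s z≤n))))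

onesAux-fuel : ∀ {f g n} → n ≤ f → n ≤ g → onesAux f n ≡ onesAux g n
onesAux-fuel {zero}  {zero}  _   _   = refl
onesAux-fuel {zero}  {suc g} z≤n _   = sym (onesAux-zero (suc g))
onesAux-fuel {suc f} {zero}  _   z≤n = onesAux-zero (suc f)
onesAux-fuel {suc f} {suc g} {n} n≤f n≤g =
  cong (n % 2 +_) (onesAux-fuel (m≤1+n⇒m/2≤n n≤f) (m≤1+n⇒m/2≤n n≤g))

ones-unfold : ∀ n → ones n ≡ n % 2 + ones (n / 2)
ones-unfold zero    = refl
ones-unfold (suc n) = cong (suc n % 2 +_) (onesAux-fuel {n} (m≤1+n⇒m/2≤n ≤-refl) ≤-refl)

-- Doubling is written n * 2, so that suc n * 2 reduces to suc (suc (n * 2)).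
ones-double : ∀ n → ones (n * 2) ≡ ones n
ones-double n = trans (ones-unfold (n * 2)) (cong₂ (λ r h → r + ones h) (m*n%n≡0 n 2) (m*n/n≡m n 2))

[1+n*2]/2≡n : ∀ n → suc (n * 2) / 2 ≡ n
[1+n*2]/2≡n zero    = refl
[1+n*2]/2≡n (suc n) =
  trans (m/n≡1+[m∸n]/n {suc (suc (suc (n * 2)))} {2} (s≤s (s≤s z≤n))) (cong suc ([1+n*2]/2≡n n))

ones-double+1 : ∀ n → ones (suc (n * 2)) ≡ suc (ones n)
ones-double+1 n =
  trans (ones-unfold (suc (n * 2))) (cong₂ (λ r h → r + ones h) ([m+kn]%n≡m%n 1 n 2) ([1+n*2]/2≡n n))

t-double : ∀ n → t (n * 2) ≡ t n
t-double n = trans (t≡isOdd∘ones (n * 2)) (trans (cong isOdd (ones-double n)) (sym (t≡isOdd∘ones n)))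

t-double+1 : ∀ n → t (suc (n * 2)) ≡ not (t n)
t-double+1 n = trans (t≡isOdd∘ones (suc (n * 2)))
  (trans (cong isOdd (ones-double+1 n)) (cong not (sym (t≡isOdd∘ones n))))

-- Counting admissible words

count : {A : Set} → (A → Bool) → List A → ℕ
count p xs = length (filter (λ x → p x ≟ true) xs)

count-++ : {A : Set} (p : A → Bool) (xs ys : List A) → count p (xs ++ ys) ≡ count p xs + count p ys
count-++ p xs ys = trans (cong length (filter-++ (λ x → p x ≟ true) xs ys)) (length-++ (filter _ xs))

count-map : {A B : Set} (p : B → Bool) (f : A → B) (xs : List A) → count p (map f xs) ≡ count (p ∘ f) xs
count-map p f []       = refl
count-map p f (x ∷ xs) with p (f x)
... | true  = cong suc (count-map p f xs)
... | false = count-map p f xs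

count-false∧ : {A : Set} (p : A → Bool) (xs : List A) → count (λ x → false ∧ p x) xs ≡ 0
count-false∧ p []       = refl
count-false∧ p (x ∷ xs) = count-false∧ p xs

count-∧ : {A : Set} (c : Bool) (p : A → Bool) (xs : List A) →
  count (λ x → c ∧ p x) xs ≡ (if c then count p xs else 0)
count-∧ true  p xs = refl
count-∧ false p xs = count-false∧ p xs

count-allWords-suc : ∀ {n} (p : Vec Bool (suc n) → Bool) →
  count p (allWords (suc n)) ≡
  count (λ w → p (false ∷ w)) (allWords n) + count (λ w → p (true ∷ w)) (allWords n)
count-allWords-suc {n} p = trans (count-++ p (map (false ∷_) (allWords n)) _)
  (cong₂ _+_ (count-map p (false ∷_) (allWords n)) (count-map p (true ∷_) (allWords n)))

continuations : ℕ → Bool → ℕ → ℕ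
continuations i a L = count (λ w → okFrom i (a ∷ toList w)) (allWords L)

u-suc : ∀ n → u (suc n) ≡ continuations 0 false n + continuations 0 true n
u-suc n = count-allWords-suc {n} inLJ

not-∧-not : ∀ a b → not (not a ∧ not b) ≡ a ∨ b
not-∧-not true  b = refl
not-∧-not false b = not-involutive b

continuations-suc : ∀ i a L → continuations i a (suc L) ≡
  continuations (suc i) false L + (if a ∨ t i then continuations (suc i) true L else 0)
continuations-suc i a L = trans (count-allWords-suc {L} (λ w → okFrom i (a ∷ toList w)))
  (cong (continuations (suc i) false L +_)
    (trans (count-∧ (not (not a ∧ not (t i))) (λ w → okFrom (suc i) (true ∷ toList w)) (allWords L))
           (cong (λ c → if c then continuations (suc i) true L else 0) (not-∧-not a (t i)))))

if-≤ : ∀ c n → (if c then n else 0) ≤ n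
if-≤ true  n = ≤-refl
if-≤ false n = z≤n

continuations-bounds : ∀ i a L → 1 ≤ continuations i a L × continuations i a L ≤ 2 ^ L
continuations-bounds i a zero    = ≤-refl , ≤-refl
continuations-bounds i a (suc L) rewrite continuations-suc i a L =
  ≤-trans F-lower (m≤m+n _ _) ,
  +-mono-≤ F-upper (≤-trans (if-≤ (a ∨ t i) _) T-upper)
  where
    F-lower : 1 ≤ continuations (suc i) false L
    F-lower = proj₁ (continuations-bounds (suc i) false L)
    F-upper : continuations (suc i) false L ≤ 2 ^ L
    F-upper = proj₂ (continuations-bounds (suc i) false L)
    T-upper : continuations (suc i) true L ≤ 2 ^ L + 0
    T-upper = ≤-trans (proj₂ (continuations-bounds (suc i) true L)) (m≤m+n (2 ^ L) 0)

continuations-free : ∀ {i} L → t i ≡ true → continuations i false L ≡ continuations i true L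
continuations-free zero    _  = refl
continuations-free {i} (suc L) ti rewrite continuations-suc i false L | continuations-suc i true L | ti = refl

ratio : Bool → ℕ
ratio b = if b then 1 else 2

continuations-ratio : ∀ j K →
  continuations (j * 2) true (suc K) ≡ ratio (t j) * continuations (j * 2) false (suc K)
continuations-ratio j K
  rewrite continuations-suc (j * 2) true K | continuations-suc (j * 2) false K | t-double j
  with t j in tj
... | true  = sym (+-identityʳ _)
... | false = trans (cong (F +_) (sym (continuations-free K (trans (t-double+1 j) (cong not tj))))) (twice F)
  where
    F : ℕ
    F = continuations (suc (j * 2)) false K
    twice : ∀ x → x + x ≡ 2 * (x + 0)
    twice = solve-∀

-- Passing over blocks of two positions

pairProduct : (Bool → Bool → ℕ) → ℕ → ℕ
pairProduct f zero    = 1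
pairProduct f (suc n) = pairProduct f n * f (t n) (t (suc n))

blockFactor : Bool → Bool → ℕ
blockFactor x y = suc (bit x + ratio y)

blockProduct : ℕ → ℕ
blockProduct = pairProduct blockFactor

block-arithmetic : ∀ x {r F T} → T ≡ r * F →
  F + (if not x then T else 0) + (if x then F + T else 0) ≡ suc (bit x + r) * F
block-arithmetic false         refl = +-identityʳ _
block-arithmetic true  {r} {F} refl = cong (_+ (F + r * F)) (+-identityʳ F)

continuations-block : ∀ m K → continuations (m * 2) false (suc (suc (suc K))) ≡
  blockFactor (t m) (t (suc m)) * continuations (suc m * 2) false (suc K)
continuations-block m K
  rewrite continuations-suc (m * 2) false (suc (suc K))
        | continuations-suc (suc (m * 2)) false (suc K)
        | continuations-suc (suc (m * 2)) true (suc K)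
        | t-double m
        | t-double+1 m
  = block-arithmetic (t m) (continuations-ratio (suc m) K)

continuations-iterate : ∀ L K → continuations 0 false (suc K + L * 2) ≡
  blockProduct L * continuations (L * 2) false (suc K)
continuations-iterate zero    K =
  trans (cong (λ n → continuations 0 false (suc n)) (+-identityʳ K)) (sym (*-identityˡ _))
continuations-iterate (suc L) K = begin
  continuations 0 false (suc K + suc L * 2)
    ≡⟨ cong (λ n → continuations 0 false (suc n)) (trans (+-suc K _) (cong suc (+-suc K _))) ⟩
  continuations 0 false (suc (suc (suc K)) + L * 2)
    ≡⟨ continuations-iterate L (suc (suc K)) ⟩
  blockProduct L * continuations (L * 2) false (suc (suc (suc K)))
    ≡⟨ cong (blockProduct L *_) (continuations-block L K) ⟩
  blockProduct L * (blockFactor (t L) (t (suc L)) * continuations (suc L * 2) false (suc K))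
    ≡⟨ *-assoc (blockProduct L) _ _ ⟨
  blockProduct (suc L) * continuations (suc L * 2) false (suc K) ∎
  where open ≡-Reasoning

u≡3*continuations : ∀ n → u (suc (suc n)) ≡ 3 * continuations 0 false (suc n)
u≡3*continuations n = trans (u-suc (suc n)) (trans (cong (F +_) (continuations-ratio 0 n)) (triple F))
  where
    F : ℕ
    F = continuations 0 false (suc n)
    triple : ∀ x → x + 2 * x ≡ 3 * x
    triple = solve-∀

u-block-formula : ∀ L K →
  u (suc (suc (K + L * 2))) ≡ 3 * (blockProduct L * continuations (L * 2) false (suc K))
u-block-formula L K = trans (u≡3*continuations (K + L * 2)) (cong (3 *_) (continuations-iterate L K))

-- Comparing the block product with 576^L

pairProduct-double+1 : ∀ f n → pairProduct f (suc (n * 2)) ≡ pairProduct f (n * 2) * f (t n) (not (t n))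
pairProduct-double+1 f n = cong₂ (λ x y → pairProduct f (n * 2) * f x y) (t-double n) (t-double+1 n)

pairProduct-double : ∀ f n → pairProduct f (suc n * 2) ≡
  pairProduct f (n * 2) * f (t n) (not (t n)) * f (not (t n)) (t (suc n))
pairProduct-double f n =
  trans (cong (λ z → pairProduct f (suc (n * 2)) * f (t (suc (n * 2))) z) (t-double (suc n)))
        (cong₂ (λ p y → p * f y (t (suc n))) (pairProduct-double+1 f n) (t-double+1 n))

weight : ℕ → ℕ → Bool → Bool → ℕ
weight a b false false = a
weight a b true  true  = a
weight a b true  false = b
weight a b false true  = 1

weight-alternating : ∀ a b x → weight a b x (not x) ≡ b ^ bit x
weight-alternating a b false = refl
weight-alternating a b true  = sym (*-identityʳ b)

weight-triple : ∀ a b x y → weight a b (not x) y * weight a b x y * b ^ bit y ≡ a * b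
weight-triple a b false false = trans (*-identityʳ (b * a)) (*-comm b a)
weight-triple a b false true  = cong₂ _*_ (*-identityʳ a) (*-identityʳ b)
weight-triple a b true  false = *-identityʳ (a * b)
weight-triple a b true  true  = cong₂ _*_ (*-identityˡ a) (*-identityʳ b)

weight-double : ∀ a b n →
  pairProduct (weight a b) (n * 2) * (pairProduct (weight a b) n * b ^ bit (t n)) ≡ (a * b) ^ n
weight-double a b zero    = refl
weight-double a b (suc n) = begin
  P (suc n * 2) * (P (suc n) * b ^ bit y)
    ≡⟨ cong (_* (P (suc n) * b ^ bit y)) (pairProduct-double (weight a b) n) ⟩
  P (n * 2) * w x (not x) * w (not x) y * (P n * w x y * b ^ bit y)
    ≡⟨ regroup (P (n * 2)) (P n) (w x (not x)) (w (not x) y) (w x y) (b ^ bit y) ⟩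
  P (n * 2) * (P n * w x (not x)) * (w (not x) y * w x y * b ^ bit y)
    ≡⟨ cong₂ (λ c d → P (n * 2) * (P n * c) * d) (weight-alternating a b x) (weight-triple a b x y) ⟩
  P (n * 2) * (P n * b ^ bit x) * (a * b)
    ≡⟨ cong (_* (a * b)) (weight-double a b n) ⟩
  (a * b) ^ n * (a * b)
    ≡⟨ *-comm _ (a * b) ⟩
  (a * b) ^ suc n ∎
  where
    open ≡-Reasoning
    P : ℕ → ℕ
    P = pairProduct (weight a b)
    w : Bool → Bool → ℕ
    w = weight a b
    x y : Bool
    x = t n
    y = t (suc n)
    regroup : ∀ p q u v w s → p * u * v * (q * w * s) ≡ p * (q * u) * (v * w * s)
    regroup = solve-∀

weight-double+1 : ∀ a b n → pairProduct (weight a b) (suc (n * 2)) * pairProduct (weight a b) n ≡ (a * b) ^ n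
weight-double+1 a b n = begin
  P (suc (n * 2)) * P n                ≡⟨ cong (_* P n) (pairProduct-double+1 (weight a b) n) ⟩
  P (n * 2) * w (t n) (not (t n)) * P n ≡⟨ regroup (P (n * 2)) (P n) (w (t n) (not (t n))) ⟩
  P (n * 2) * (P n * w (t n) (not (t n))) ≡⟨ cong (λ c → P (n * 2) * (P n * c)) (weight-alternating a b (t n)) ⟩
  P (n * 2) * (P n * b ^ bit (t n))    ≡⟨ weight-double a b n ⟩
  (a * b) ^ n                          ∎
  where
    open ≡-Reasoning
    P : ℕ → ℕ
    P = pairProduct (weight a b)
    w : Bool → Bool → ℕ
    w = weight a b
    regroup : ∀ p q u → p * u * q ≡ p * (q * u)
    regroup = solve-∀

even-or-odd : ∀ n → ∃ λ h → n ≡ h * 2 ⊎ n ≡ suc (h * 2)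
even-or-odd zero = 0 , inj₁ refl
even-or-odd (suc n) with even-or-odd n
... | h , inj₁ refl = h , inj₂ refl
... | h , inj₂ refl = suc h , inj₁ refl

half-<-pow : ∀ {h n k} → h * 2 ≤ n → n < 2 ^ suc k → h < 2 ^ k
half-<-pow {h} {n} {k} h2≤n n<2^1+k = *-cancelʳ-< 2 h (2 ^ k) (begin-strict
  h * 2 ≤⟨ h2≤n ⟩ n <⟨ n<2^1+k ⟩ 2 * 2 ^ k ≡⟨ *-comm 2 (2 ^ k) ⟩ 2 ^ k * 2 ∎)
  where open ≤-Reasoning

pow2-between : ∀ n → ∃ λ k → n < 2 ^ k × 2 ^ k ≤ suc n * 2
pow2-between zero = 0 , s≤s z≤n , s≤s z≤n
pow2-between (suc n) with pow2-between n
... | k , n<2^k , 2^k≤ with m≤n⇒m<n∨m≡n n<2^k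
...   | inj₁ 1+n<2^k = k , 1+n<2^k , ≤-trans 2^k≤ (*-monoˡ-≤ 2 (n≤1+n (suc n)))
...   | inj₂ 1+n≡2^k = suc k , lower , upper
  where
    open ≤-Reasoning
    lower : suc n < 2 ^ suc k
    lower = begin-strict
      suc n     <⟨ m<m*n (suc n) 2 (s≤s (s≤s z≤n)) ⟩
      suc n * 2 ≡⟨ *-comm (suc n) 2 ⟩
      2 * suc n ≡⟨ cong (2 *_) 1+n≡2^k ⟩
      2 ^ suc k ∎
    upper : 2 ^ suc k ≤ suc (suc n) * 2
    upper = begin
      2 ^ suc k       ≡⟨ cong (2 *_) 1+n≡2^k ⟨
      2 * suc n       ≡⟨ *-comm 2 (suc n) ⟩
      suc n * 2       ≤⟨ *-monoˡ-≤ 2 (n≤1+n (suc n)) ⟩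
      suc (suc n) * 2 ∎

pairProduct-pos : ∀ {f} → (∀ x y → 1 ≤ f x y) → ∀ n → 1 ≤ pairProduct f n
pairProduct-pos pos zero    = ≤-refl
pairProduct-pos pos (suc n) = *-mono-≤ (pairProduct-pos pos n) (pos (t n) (t (suc n)))

weight-pos : ∀ {a b} → 1 ≤ a → 1 ≤ b → ∀ x y → 1 ≤ weight a b x y
weight-pos 1≤a 1≤b false false = 1≤a
weight-pos 1≤a 1≤b false true  = ≤-refl
weight-pos 1≤a 1≤b true  false = 1≤b
weight-pos 1≤a 1≤b true  true  = 1≤a

^bit-bounds : ∀ {a} → 1 ≤ a → ∀ x → 1 ≤ a ^ bit x × a ^ bit x ≤ a
^bit-bounds     1≤a false = ≤-refl , 1≤a
^bit-bounds {a} 1≤a true  rewrite *-identityʳ a = 1≤a , ≤-refl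

^bit-≤ : ∀ {a b} → a ≤ 2 * b → ∀ x → a ^ bit x ≤ 2 * b ^ bit x
^bit-≤         a≤2b false = s≤s z≤n
^bit-≤ {a} {b} a≤2b true rewrite *-identityʳ a | *-identityʳ b = a≤2b

cross-cancel : ∀ {X Y c d m} → 1 ≤ c → X * c ≡ Y * d → d ≤ m * c → X ≤ m * Y
cross-cancel {X} {Y} {c} {d} {m} 1≤c Xc≡Yd d≤mc = *-cancelʳ-≤ X (m * Y) c {{>-nonZero 1≤c}} (begin
  X * c       ≡⟨ Xc≡Yd ⟩
  Y * d       ≤⟨ *-monoʳ-≤ Y d≤mc ⟩
  Y * (m * c) ≡⟨ swap Y m c ⟩
  m * Y * c   ∎)
  where
    open ≤-Reasoning
    swap : ∀ y m c → y * (m * c) ≡ m * y * c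
    swap = solve-∀

-- The two orientations of weight-double share the right-hand side (a * b) ^ h, so cross-multiplying
-- them transfers the induction hypothesis, taken with a and b exchanged, from h to h * 2 and 1 + h * 2.
weight-balanced-pow : ∀ {a b} → 1 ≤ a → 1 ≤ b → a ≤ 2 * b → b ≤ 2 * a → ∀ k n → n < 2 ^ k →
  pairProduct (weight a b) n ≤ 2 ^ k * pairProduct (weight b a) n
weight-balanced-pow 1≤a 1≤b a≤2b b≤2a zero    zero    _         = ≤-refl
weight-balanced-pow 1≤a 1≤b a≤2b b≤2a zero    (suc n) (s≤s ())
weight-balanced-pow {a} {b} 1≤a 1≤b a≤2b b≤2a (suc k) n n<2^k+1 with even-or-odd n
... | h , inj₁ refl = cross-cancel {Y = pairProduct (weight b a) (h * 2)} {m = 2 ^ suc k}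
  (*-mono-≤ (pairProduct-pos (weight-pos 1≤a 1≤b) h) (proj₁ (^bit-bounds 1≤b (t h))))
  (trans (weight-double a b h) (trans (cong (_^ h) (*-comm a b)) (sym (weight-double b a h))))
  (begin
    pairProduct (weight b a) h * a ^ bit (t h)
      ≤⟨ *-mono-≤ (weight-balanced-pow 1≤b 1≤a b≤2a a≤2b k h (half-<-pow {k = k} ≤-refl n<2^k+1))
                  (^bit-≤ a≤2b (t h)) ⟩
    2 ^ k * pairProduct (weight a b) h * (2 * b ^ bit (t h))
      ≡⟨ regroup (2 ^ k) (pairProduct (weight a b) h) (b ^ bit (t h)) ⟩
    2 ^ suc k * (pairProduct (weight a b) h * b ^ bit (t h)) ∎)
  where
    open ≤-Reasoning
    regroup : ∀ p q r → p * q * (2 * r) ≡ 2 * p * (q * r)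
    regroup = solve-∀
... | h , inj₂ refl = cross-cancel {Y = pairProduct (weight b a) (suc (h * 2))} {m = 2 ^ suc k}
  (pairProduct-pos (weight-pos 1≤a 1≤b) h)
  (trans (weight-double+1 a b h) (trans (cong (_^ h) (*-comm a b)) (sym (weight-double+1 b a h))))
  (≤-trans (weight-balanced-pow 1≤b 1≤a b≤2a a≤2b k h (half-<-pow {k = k} (n≤1+n _) n<2^k+1))
           (*-monoˡ-≤ _ (m≤n*m (2 ^ k) 2)))

weight-balanced : ∀ {a b} → 1 ≤ a → 1 ≤ b → a ≤ 2 * b → b ≤ 2 * a → ∀ n →
  pairProduct (weight a b) n ≤ suc n * 2 * pairProduct (weight b a) n
weight-balanced 1≤a 1≤b a≤2b b≤2a n with pow2-between n
... | k , n<2^k , 2^k≤ = ≤-trans (weight-balanced-pow 1≤a 1≤b a≤2b b≤2a k n n<2^k) (*-monoˡ-≤ _ 2^k≤)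

^-distribʳ-* : ∀ m n o → (m * n) ^ o ≡ m ^ o * n ^ o
^-distribʳ-* m n zero    = refl
^-distribʳ-* m n (suc o) = trans (cong (m * n *_) (^-distribʳ-* m n o)) (swap m n (m ^ o) (n ^ o))
  where
    swap : ∀ a b c d → a * b * (c * d) ≡ a * c * (b * d)
    swap = solve-∀

blockFactor-weights : ∀ x y →
  blockFactor x y ^ 6 * 9 ^ bit y * weight 64 81 x y ≡ 9 ^ bit x * (576 * weight 81 64 x y)
blockFactor-weights false false = refl
blockFactor-weights false true  = refl
blockFactor-weights true  false = refl
blockFactor-weights true  true  = refl

blockProduct-identity : ∀ L →
  blockProduct L ^ 6 * 9 ^ bit (t L) * pairProduct (weight 64 81) L ≡ 576 ^ L * pairProduct (weight 81 64) L
blockProduct-identity zero    = refl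
blockProduct-identity (suc L) = begin
  (P * g) ^ 6 * 9 ^ bit y * (B * β)     ≡⟨ cong (λ z → z * 9 ^ bit y * (B * β)) (^-distribʳ-* P g 6) ⟩
  P ^ 6 * g ^ 6 * 9 ^ bit y * (B * β)   ≡⟨ regroup₁ (P ^ 6) (g ^ 6) (9 ^ bit y) B β ⟩
  P ^ 6 * B * (g ^ 6 * 9 ^ bit y * β)   ≡⟨ cong (P ^ 6 * B *_) (blockFactor-weights x y) ⟩
  P ^ 6 * B * (9 ^ bit x * (576 * α))   ≡⟨ regroup₂ (P ^ 6) B (9 ^ bit x) (576 * α) ⟩
  P ^ 6 * 9 ^ bit x * B * (576 * α)     ≡⟨ cong (_* (576 * α)) (blockProduct-identity L) ⟩
  576 ^ L * A * (576 * α)               ≡⟨ regroup₃ (576 ^ L) A α ⟩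
  576 ^ suc L * (A * α)                 ∎
  where
    open ≡-Reasoning
    x y : Bool
    x = t L
    y = t (suc L)
    P g A α B β : ℕ
    P = blockProduct L
    g = blockFactor x y
    A = pairProduct (weight 81 64) L
    α = weight 81 64 x y
    B = pairProduct (weight 64 81) L
    β = weight 64 81 x y
    regroup₁ : ∀ p q s b c → p * q * s * (b * c) ≡ p * b * (q * s * c)
    regroup₁ = solve-∀
    regroup₂ : ∀ q b s r → q * b * (s * r) ≡ q * s * b * r
    regroup₂ = solve-∀
    regroup₃ : ∀ q a c → q * a * (576 * c) ≡ 576 * q * (a * c)
    regroup₃ = solve-∀

weight-81-64-balanced : ∀ L →
  pairProduct (weight 81 64) L ≤ suc L * 2 * pairProduct (weight 64 81) L ×
  pairProduct (weight 64 81) L ≤ suc L * 2 * pairProduct (weight 81 64) L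
weight-81-64-balanced L =
  weight-balanced 1≤81 1≤64 81≤128 64≤162 L , weight-balanced 1≤64 1≤81 64≤162 81≤128 L
  where
    1≤81 : 1 ≤ 81
    1≤81 = s≤s z≤n
    1≤64 : 1 ≤ 64
    1≤64 = s≤s z≤n
    81≤128 : 81 ≤ 2 * 64
    81≤128 = ≤ᵇ⇒≤ 81 128 _
    64≤162 : 64 ≤ 2 * 81
    64≤162 = ≤ᵇ⇒≤ 64 162 _

blockProduct-upper : ∀ L → blockProduct L ^ 6 ≤ suc L * 2 * 576 ^ L
blockProduct-upper L = *-cancelʳ-≤ (P ^ 6) (suc L * 2 * 576 ^ L) B {{>-nonZero B-pos}} (begin
  P ^ 6 * B                    ≤⟨ *-monoˡ-≤ B (m≤m*n (P ^ 6) (9 ^ bit (t L)) {{>-nonZero 1≤9^t}}) ⟩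
  P ^ 6 * 9 ^ bit (t L) * B    ≡⟨ blockProduct-identity L ⟩
  576 ^ L * A                  ≤⟨ *-monoʳ-≤ (576 ^ L) (proj₁ (weight-81-64-balanced L)) ⟩
  576 ^ L * (suc L * 2 * B)    ≡⟨ regroup (576 ^ L) (suc L * 2) B ⟩
  suc L * 2 * 576 ^ L * B      ∎)
  where
    open ≤-Reasoning
    P A B : ℕ
    P = blockProduct L
    A = pairProduct (weight 81 64) L
    B = pairProduct (weight 64 81) L
    B-pos : 1 ≤ B
    B-pos = pairProduct-pos (weight-pos (s≤s z≤n) (s≤s z≤n)) L
    1≤9^t : 1 ≤ 9 ^ bit (t L)
    1≤9^t = proj₁ (^bit-bounds (s≤s z≤n) (t L))
    regroup : ∀ q s b → q * (s * b) ≡ s * q * b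
    regroup = solve-∀

blockProduct-lower : ∀ L → 576 ^ L ≤ 9 * (suc L * 2) * blockProduct L ^ 6
blockProduct-lower L = *-cancelʳ-≤ (576 ^ L) (9 * (suc L * 2) * P ^ 6) A {{>-nonZero A-pos}} (begin
  576 ^ L * A                   ≡⟨ blockProduct-identity L ⟨
  P ^ 6 * 9 ^ bit (t L) * B     ≤⟨ *-mono-≤ (*-monoʳ-≤ (P ^ 6) 9^t≤9) (proj₂ (weight-81-64-balanced L)) ⟩
  P ^ 6 * 9 * (suc L * 2 * A)   ≡⟨ regroup (P ^ 6) (suc L * 2) A ⟩
  9 * (suc L * 2) * P ^ 6 * A   ∎)
  where
    open ≤-Reasoning
    P A B : ℕ
    P = blockProduct L
    A = pairProduct (weight 81 64) L
    B = pairProduct (weight 64 81) L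
    A-pos : 1 ≤ A
    A-pos = pairProduct-pos (weight-pos (s≤s z≤n) (s≤s z≤n)) L
    9^t≤9 : 9 ^ bit (t L) ≤ 9
    9^t≤9 = proj₂ (^bit-bounds (s≤s z≤n) (t L))
    regroup : ∀ p s a → p * 9 * (s * a) ≡ 9 * s * p * a
    regroup = solve-∀

24^-block : ∀ L K → 24 ^ suc (suc (K + L * 2)) ≡ 24 ^ suc (suc K) * 576 ^ L
24^-block L K = trans (^-distribˡ-+-* 24 (suc (suc K)) (L * 2))
  (cong (24 ^ suc (suc K) *_) (trans (cong (24 ^_) (*-comm L 2)) (sym (^-*-assoc 24 2 L))))

≤-pow : ∀ {c n} k → c ≤ 2 ^ k → 2 ≤ n → c ≤ n ^ k
≤-pow k c≤2^k 2≤n = ≤-trans c≤2^k (^-monoˡ-≤ k 2≤n)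

Bounds : ℕ → Set
Bounds n = (24 ^ n ≤ n ^ 18 * u n ^ 6) × (u n ^ 6 ≤ n ^ 23 * 24 ^ n)

-- n is kept abstract: for n = suc (suc …) the conversion checker would unfold n ^ 18.
bounds-at-block : ∀ n L K → K ≤ 1 → n ≡ suc (suc (K + L * 2)) → Bounds n
bounds-at-block n L K K≤1 n≡ = lower , upper
  where
    open ≤-Reasoning
    P r U : ℕ
    P = blockProduct L
    r = continuations (L * 2) false (suc K)
    U = 3 * (P * r)
    u≡U : u n ≡ U
    u≡U = trans (cong u n≡) (u-block-formula L K)
    24^n≡ : 24 ^ n ≡ 24 ^ suc (suc K) * 576 ^ L
    24^n≡ = trans (cong (24 ^_) n≡) (24^-block L K)
    2≤n : 2 ≤ n
    2≤n = subst (2 ≤_) (sym n≡) (s≤s (s≤s z≤n))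
    2L+2≤n : suc L * 2 ≤ n
    2L+2≤n = subst (suc L * 2 ≤_) (sym n≡) (s≤s (s≤s (m≤n+m (L * 2) K)))
    1≤r : 1 ≤ r
    1≤r = proj₁ (continuations-bounds (L * 2) false (suc K))
    r≤4 : r ≤ 4
    r≤4 = ≤-trans (proj₂ (continuations-bounds (L * 2) false (suc K))) (^-monoʳ-≤ 2 (s≤s K≤1))
    P≤U : P ≤ U
    P≤U = ≤-trans (m≤m*n P r {{>-nonZero 1≤r}}) (m≤n*m (P * r) 3)
    576^L≤24^n : 576 ^ L ≤ 24 ^ n
    576^L≤24^n = ≤-trans (m≤n*m (576 ^ L) (24 ^ suc (suc K)) {{m^n≢0 24 (suc (suc K))}})
                         (≤-reflexive (sym 24^n≡))
    lower : 24 ^ n ≤ n ^ 18 * u n ^ 6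
    lower = begin
      24 ^ n
        ≡⟨ 24^n≡ ⟩
      24 ^ suc (suc K) * 576 ^ L
        ≤⟨ *-mono-≤ (^-monoʳ-≤ 24 (s≤s (s≤s K≤1))) (blockProduct-lower L) ⟩
      13824 * (9 * (suc L * 2) * P ^ 6)
        ≤⟨ *-monoʳ-≤ 13824 (*-mono-≤ (*-monoʳ-≤ 9 2L+2≤n) (^-monoˡ-≤ 6 P≤U)) ⟩
      13824 * (9 * n * U ^ 6)
        ≡⟨ regroup n (U ^ 6) ⟩
      124416 * n * U ^ 6
        ≤⟨ *-monoˡ-≤ (U ^ 6) (*-monoˡ-≤ n (≤-pow 17 (≤ᵇ⇒≤ 124416 (2 ^ 17) _) 2≤n)) ⟩
      n ^ 17 * n * U ^ 6
        ≡⟨ cong (_* U ^ 6) (*-comm (n ^ 17) n) ⟩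
      n ^ 18 * U ^ 6
        ≡⟨ cong (λ v → n ^ 18 * v ^ 6) u≡U ⟨
      n ^ 18 * u n ^ 6
        ∎
      where
        regroup : ∀ m x → 13824 * (9 * m * x) ≡ 124416 * m * x
        regroup = solve-∀
    upper : u n ^ 6 ≤ n ^ 23 * 24 ^ n
    upper = begin
      u n ^ 6
        ≡⟨ cong (_^ 6) u≡U ⟩
      U ^ 6
        ≡⟨ ^-distribʳ-* 3 (P * r) 6 ⟩
      729 * (P * r) ^ 6
        ≡⟨ cong (729 *_) (^-distribʳ-* P r 6) ⟩
      729 * (P ^ 6 * r ^ 6)
        ≤⟨ *-monoʳ-≤ 729 (*-mono-≤ (blockProduct-upper L) (^-monoˡ-≤ 6 r≤4)) ⟩
      729 * (suc L * 2 * 576 ^ L * 4096)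
        ≤⟨ *-monoʳ-≤ 729 (*-monoˡ-≤ 4096 (*-mono-≤ 2L+2≤n 576^L≤24^n)) ⟩
      729 * (n * 24 ^ n * 4096)
        ≡⟨ regroup n (24 ^ n) ⟩
      2985984 * n * 24 ^ n
        ≤⟨ *-monoˡ-≤ (24 ^ n) (*-monoˡ-≤ n (≤-pow 22 (≤ᵇ⇒≤ 2985984 (2 ^ 22) _) 2≤n)) ⟩
      n ^ 22 * n * 24 ^ n
        ≡⟨ cong (_* 24 ^ n) (*-comm (n ^ 22) n) ⟩
      n ^ 23 * 24 ^ n
        ∎
      where
        regroup : ∀ m x → 729 * (m * x * 4096) ≡ 2985984 * m * x
        regroup = solve-∀

theorem10 : ∃₂ λ (k₁ k₂ : ℕ) → ∀ (n : ℕ) → 2 ≤ n →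
    (24 ^ n ≤ n ^ k₁ * u n ^ 6) × (u n ^ 6 ≤ n ^ k₂ * 24 ^ n)
theorem10 = 18 , 23 , bounds
  where
    bounds-of-parity : ∀ m → (∃ λ L → m ≡ L * 2 ⊎ m ≡ suc (L * 2)) → Bounds (suc (suc m))
    bounds-of-parity m (L , inj₁ m≡2L)   = bounds-at-block (suc (suc m)) L 0 z≤n (cong (2 +_) m≡2L)
    bounds-of-parity m (L , inj₂ m≡1+2L) = bounds-at-block (suc (suc m)) L 1 ≤-refl (cong (2 +_) m≡1+2L)
    bounds : ∀ n → 2 ≤ n → Bounds n
    bounds (suc (suc m)) _ = bounds-of-parity m (even-or-odd m)
    bounds (suc zero) (s≤s ())
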